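{- Let $G$ be a graph, $k$ an integer, $S\subseteq V(G)$, and let $\mathcal{C}$ be the set of all inclusion-wise maximal chips with respect to $S$ and $k$. For $C_1,C_2\in\mathcal{C}$ with $C_1\neq C_2$, $C_1$ touches $C_2$ if and only if $N(C_1)\cap C_2\neq\emptyset$.
   Context: $N(C)$ denotes the set of vertices outside $C$ adjacent to $C$. A set $W$ is an $X$–$Y$ separator if no component of $G\setminus W$ contains a vertex of $X$ and a vertex of $Y$. $R_H(A)$ is the set of vertices reachable from $A$ in $H$. An inclusion-wise minimal $X$–$Y$ separator $W$ is important if there is no $X$–$Y$ separator $W'$ with $|W'|\le|W|$ and $R_{G\setminus W}(X\setminus W)\subsetneq R_{G\setminus W'}(X\setminus W')$. A chip (for $S$, $k$) is a set $C\subseteq V(G)$ with $G[C]$ connected, $|N(C)|\le 3k$, and $N(C)$ an important $C$–$S$ separator. Two chips $C_1\ne C_2$ of $\mathcal{C}$ touch if $C_1\cap C_2\neq\emptyset$ or there is an edge with one endpoint in $C_1$ and the other in $C_2$. -}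

module Defs where

open import Data.Nat using (ℕ; _≤_)
open import Data.Integer as ℤ using (ℤ; +_)
open import Data.Fin using (Fin)
open import Data.Fin.Subset using (Subset; _∈_; _∉_; _⊆_; _⊂_; ∣_∣; ∁)
open import Data.Fin.Subset.Properties using (_∈?_)
open import Data.Fin.Properties using (any?)
open import Data.Vec using (tabulate)
open import Data.Bool using (_∧_)
open import Data.Product using (Σ; ∃; _×_; _,_)
open import Data.Sum using (_⊎_)
open import Relation.Nullary using (¬_; Dec; does)
open import Relation.Nullary.Decidable using (_×-dec_; ¬?)

record Graph (n : ℕ) : Set₁ where
  field
    Adj     : Fin n → Fin n → Set
    adj?    : ∀ u v → Dec (Adj u v)
    sym     : ∀ {u v} → Adj u v → Adj v u
    irrefl  : ∀ {u} → ¬ Adj u u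

module _ {n : ℕ} (G : Graph n) where
  open Graph G

  data Reach (X : Subset n) : Fin n → Fin n → Set where
    here : ∀ {u} → u ∈ X → Reach X u u
    step : ∀ {u v w} → u ∈ X → Adj u v → Reach X v w → Reach X u w

  -- G[C] is connected (connected graphs are non-empty).
  Connected : Subset n → Set
  Connected C = (∃ λ v → v ∈ C) × (∀ u v → u ∈ C → v ∈ C → Reach C u v)

  N : Subset n → Subset n
  N C = tabulate λ v → does (¬? (v ∈? C)) ∧ does (any? λ u → (u ∈? C) ×-dec adj? u v)

  Separator : Subset n → Subset n → Subset n → Set
  Separator X Y W = ∀ x y → x ∈ X → y ∈ Y → ¬ Reach (∁ W) x y

  MinimalSeparator : Subset n → Subset n → Subset n → Set
  MinimalSeparator X Y W = Separator X Y W × (∀ W' → W' ⊂ W → ¬ Separator X Y W')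

  Reachable : Subset n → Subset n → Fin n → Set
  Reachable X W v = ∃ λ x → x ∈ X × Reach (∁ W) x v

  _⊊ᴾ_ : (Fin n → Set) → (Fin n → Set) → Set
  P ⊊ᴾ Q = (∀ v → P v → Q v) × (∃ λ v → Q v × ¬ P v)

  ImportantSeparator : Subset n → Subset n → Subset n → Set
  ImportantSeparator X Y W =
    MinimalSeparator X Y W ×
    ¬ (∃ λ W' → Separator X Y W' × ∣ W' ∣ ≤ ∣ W ∣ × (Reachable X W ⊊ᴾ Reachable X W'))

  Chip : Subset n → ℤ → Subset n → Set
  Chip S k C = Connected C × (+ ∣ N C ∣) ℤ.≤ (+ 3) ℤ.* k × ImportantSeparator C S (N C)

  MaximalChip : Subset n → ℤ → Subset n → Set
  MaximalChip S k C = Chip S k C × (∀ C' → Chip S k C' → C ⊆ C' → C' ⊆ C)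

  Touch : Subset n → Subset n → Set
  Touch C₁ C₂ = (∃ λ v → v ∈ C₁ × v ∈ C₂) ⊎ (∃ λ u → ∃ λ v → u ∈ C₁ × v ∈ C₂ × Adj u v)

module Submission where

open import Defs
open import Data.Nat using (ℕ)
open import Data.Integer using (ℤ)
open import Data.Fin using (Fin)
open import Data.Fin.Subset using (Subset; _∩_; Nonempty; _∈_; _∉_; _⊆_)
open import Data.Fin.Subset.Properties using (_∈?_; x∈p∩q⁺; x∈p∩q⁻; ⊆-antisym)
open import Data.Fin.Properties using (any?)
open import Data.Vec.Properties using (lookup∘tabulate; []=⇒lookup; lookup⇒[]=)
open import Data.Bool using (true; _∧_)
open import Data.Product using (∃; _×_; _,_)
open import Data.Sum using (_⊎_; inj₁; inj₂; [_,_])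
open import Data.Empty using (⊥-elim)
open import Relation.Nullary using (¬_; yes; no; does)
open import Relation.Nullary.Decidable using (_×-dec_; ¬?)
open import Relation.Binary.PropositionalEquality using (_≢_; _≡_; refl; trans; sym)
open import Function using (id)
open import Function.Bundles using (_⇔_; mk⇔)

-- If C₂ ≠ C₁ is maximal then C₂ ⊈ C₁, so C₂ has a vertex outside C₁; a walk in the
-- connected set C₂ from a vertex of C₁ (or from the far end of an edge leaving C₁)
-- to that vertex must step out of C₁, and the first vertex it reaches outside C₁
-- lies in N(C₁) ∩ C₂.

⊈⇒∃∉ : ∀ {n} {P Q : Subset n} → ¬ P ⊆ Q → ∃ λ x → x ∈ P × x ∉ Q
⊈⇒∃∉ {P = P} {Q} P⊈Q with any? (λ x → (x ∈? P) ×-dec ¬? (x ∈? Q))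
... | yes witness = witness
... | no none     = ⊥-elim (P⊈Q P⊆Q)
  where
  P⊆Q : P ⊆ Q
  P⊆Q {x} x∈P with x ∈? Q
  ... | yes x∈Q = x∈Q
  ... | no  x∉Q = ⊥-elim (none (x , x∈P , x∉Q))

module _ {n : ℕ} (G : Graph n) where
  open Graph G using (Adj; adj?)

  private
    NTest : Subset n → Fin n → Set
    NTest C x = (does (¬? (x ∈? C)) ∧ does (any? λ u → (u ∈? C) ×-dec adj? u x)) ≡ true

  ∈N⁺ : ∀ {C x u} → x ∉ C → u ∈ C → Adj u x → x ∈ N G C
  ∈N⁺ {C} {x} {u} x∉C u∈C u~x = lookup⇒[]= x (N G C) (trans (lookup∘tabulate _ x) test)
    where
    test : NTest C x
    test with x ∈? C | any? (λ u → (u ∈? C) ×-dec adj? u x)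
    ... | yes x∈C | _       = ⊥-elim (x∉C x∈C)
    ... | no _    | yes _   = refl
    ... | no _    | no none = ⊥-elim (none (u , u∈C , u~x))

  ∈N⁻ : ∀ {C x} → x ∈ N G C → x ∉ C × ∃ λ u → u ∈ C × Adj u x
  ∈N⁻ {C} {x} x∈NC = decode (trans (sym (lookup∘tabulate _ x)) ([]=⇒lookup x∈NC))
    where
    decode : NTest C x → x ∉ C × ∃ λ u → u ∈ C × Adj u x
    decode test with x ∈? C | any? (λ u → (u ∈? C) ×-dec adj? u x)
    decode ()   | yes _   | _
    decode refl | no x∉C  | yes nbr = x∉C , nbr
    decode ()   | no _    | no _

  Reach-source : ∀ {X u w} → Reach G X u w → u ∈ X
  Reach-source (here u∈X)     = u∈X
  Reach-source (step u∈X _ _) = u∈X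

  Reach-leaving⇒N∩ : ∀ {C D v w} → Reach G D v w → v ∈ C → w ∉ C → Nonempty (N G C ∩ D)
  Reach-leaving⇒N∩ (here _) v∈C w∉C = ⊥-elim (w∉C v∈C)
  Reach-leaving⇒N∩ {C} (step {v = v'} _ v~v' walk) v∈C w∉C with v' ∈? C
  ... | yes v'∈C = Reach-leaving⇒N∩ walk v'∈C w∉C
  ... | no  v'∉C = v' , x∈p∩q⁺ (∈N⁺ v'∉C v∈C v~v' , Reach-source walk)

  Connected-meets⇒N∩ : ∀ {C D v} → Connected G D → ¬ D ⊆ C → v ∈ C → v ∈ D →
                       Nonempty (N G C ∩ D)
  Connected-meets⇒N∩ (_ , connect) D⊈C v∈C v∈D with ⊈⇒∃∉ D⊈C
  ... | w , w∈D , w∉C = Reach-leaving⇒N∩ (connect _ w v∈D w∈D) v∈C w∉C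

  Touch⇒shared⊎N∩ : ∀ {C D} → Touch G C D →
                    (∃ λ v → v ∈ C × v ∈ D) ⊎ Nonempty (N G C ∩ D)
  Touch⇒shared⊎N∩ (inj₁ shared) = inj₁ shared
  Touch⇒shared⊎N∩ {C} (inj₂ (u , v , u∈C , v∈D , u~v)) with v ∈? C
  ... | yes v∈C = inj₁ (v , v∈C , v∈D)
  ... | no  v∉C = inj₂ (v , x∈p∩q⁺ (∈N⁺ v∉C u∈C u~v , v∈D))

  N∩⇒Touch : ∀ {C D} → Nonempty (N G C ∩ D) → Touch G C D
  N∩⇒Touch {C} {D} (x , x∈NC∩D) with x∈p∩q⁻ (N G C) D x∈NC∩D
  ... | x∈NC , x∈D with ∈N⁻ x∈NC
  ... | _ , u , u∈C , u~x = inj₂ (u , x , u∈C , x∈D , u~x)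

  MaximalChip-⊈ : ∀ {S k C D} → Chip G S k C → MaximalChip G S k D → C ≢ D → ¬ D ⊆ C
  MaximalChip-⊈ {C = C} chipC (_ , maximal) C≢D D⊆C =
    C≢D (⊆-antisym (maximal C chipC D⊆C) D⊆C)

lemma5 : ∀ {n : ℕ} (G : Graph n) (k : ℤ) (S C₁ C₂ : Subset n) →
    MaximalChip G S k C₁ → MaximalChip G S k C₂ → C₁ ≢ C₂ →
    Touch G C₁ C₂ ⇔ Nonempty (N G C₁ ∩ C₂)
lemma5 G k S C₁ C₂ (chip₁ , _) max₂@((connected₂ , _) , _) C₁≢C₂ =
  mk⇔ (λ touch → [ (λ (_ , v∈C₁ , v∈C₂) → Connected-meets⇒N∩ G connected₂ C₂⊈C₁ v∈C₁ v∈C₂)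
                 , id ] (Touch⇒shared⊎N∩ G touch))
      (N∩⇒Touch G)
  where
  C₂⊈C₁ : ¬ C₂ ⊆ C₁
  C₂⊈C₁ = MaximalChip-⊈ G chip₁ max₂ C₁≢C₂
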